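{- For any complete graph $K_r$ ($r\ge 1$) and any cycle graph $C_t$ ($t\ge 3$), $$\gamma_o(K_{r}\Box C_{t})\ge \gamma_o(K_r)\gamma_o(C_t).$$
   Context: All graphs are finite and simple; $K_r$ is the complete graph on $r$ vertices and $C_t$ the cycle on $t$ vertices. For a graph with vertex set $V$, a vertex $v$ and $S\subseteq V$, let $\delta_S(v)=|N(v)\cap S|$ and $\overline{S}=V\setminus S$. A nonempty set $S\subseteq V$ is a global offensive alliance if $\delta_S(v)\ge \delta_{\overline{S}}(v)+1$ for every $v\in\overline{S}$; $\gamma_o(G)$ is the minimum cardinality of a global offensive alliance of $G$. $G\Box H$ is the Cartesian product: vertex set $V(G)\times V(H)$, with $(a,b)\sim(c,d)$ iff ($a=c$ and $b\sim d$ in $H$) or ($a\sim c$ in $G$ and $b=d$). -}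

module Defs where

open import Data.Nat using (ℕ; zero; suc; _+_; _*_; _≤_; _<_; _≥_; _∸_)
open import Data.Nat.DivMod using (_%_; _/_)
open import Data.Nat.Properties using (_≟_)
open import Data.Fin using (Fin; toℕ; fromℕ<)
open import Data.Fin.Properties using () renaming (_≟_ to _≟ᶠ_)
open import Data.Bool using (Bool; true; false; _∧_; not; T)
open import Data.Product using (Σ; _×_; _,_; ∃; proj₁; proj₂)
open import Data.Fin using (combine; remQuot)
open import Relation.Nullary.Decidable using (⌊_⌋)
open import Relation.Binary.PropositionalEquality using (_≡_)

-- A finite graph on vertex set Fin n, given by a Boolean adjacency
-- relation. (All graphs used below -- K_r, C_t (t ≥ 3) and their
-- Cartesian product -- are concrete simple graphs: symmetric, loopless.)
record Graph : Set where
  constructor mkGraph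
  field
    n     : ℕ
    adj   : Fin n → Fin n → Bool
open Graph public

Subset : ℕ → Set
Subset n = Fin n → Bool

count : ∀ {n} → (Fin n → Bool) → ℕ
count {zero}  p = 0
count {suc n} p = (if-one (p Data.Fin.zero)) + count {n} (λ i → p (Data.Fin.suc i))
  where
  if-one : Bool → ℕ
  if-one true  = 1
  if-one false = 0

card : ∀ {n} → Subset n → ℕ
card S = count S

compl : ∀ {n} → Subset n → Subset n
compl S v = not (S v)

deg-in : (G : Graph) → Subset (n G) → Fin (n G) → ℕ
deg-in G S v = count (λ u → adj G v u ∧ S u)

IsGlobalOffensiveAlliance : (G : Graph) → Subset (n G) → Set
IsGlobalOffensiveAlliance G S =
  (1 ≤ card S) ×
  (∀ v → S v ≡ false → deg-in G S v ≥ deg-in G (compl S) v + 1)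

IsGammaO : Graph → ℕ → Set
IsGammaO G k =
  (Σ (Subset (n G)) λ S → IsGlobalOffensiveAlliance G S × card S ≡ k) ×
  (∀ S → IsGlobalOffensiveAlliance G S → k ≤ card S)

neq : ∀ {r} → Fin r → Fin r → Bool
neq u v = not ⌊ u ≟ᶠ v ⌋

cycAdj : (t : ℕ) → Fin t → Fin t → Bool
cycAdj zero ()
cycAdj (suc t) i j =
  ⌊ toℕ j ≟ (suc (toℕ i) % suc t) ⌋ Data.Bool.∨ ⌊ toℕ i ≟ (suc (toℕ j) % suc t) ⌋

K : ℕ → Graph
K r = mkGraph r neq

C : ℕ → Graph
C t = mkGraph t (cycAdj t)

-- Cartesian product G □ H on Fin (n G * n H), vertex (a , b) encoded
-- by combine a b (inverse remQuot):
-- (a,b) ~ (c,d) iff (a = c and b ~ d in H) or (a ~ c in G and b = d).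
_□_ : Graph → Graph → Graph
G □ H = mkGraph (n G * n H) λ x y →
  let a = proj₁ (remQuot {n G} (n H) x) ; b = proj₂ (remQuot {n G} (n H) x)
      c = proj₁ (remQuot {n G} (n H) y) ; d = proj₂ (remQuot {n G} (n H) y)
  in (⌊ a ≟ᶠ c ⌋ ∧ adj H b d) Data.Bool.∨ (adj G a c ∧ ⌊ b ≟ᶠ d ⌋)

module Submission where

-- Taking any ⌈r/2⌉ vertices of K_r and the even positions of C_t shows
-- γₒ(K_r) ≤ ⌈r/2⌉ and γₒ(C_t) ≤ ⌈t/2⌉, so it suffices that every global
-- offensive alliance S of K_r □ C_t has |S| ≥ ⌈r/2⌉⌈t/2⌉. The degree of a
-- vertex (a, j) of the product is its degree in the column K_r plus its
-- degree in the row C_t. If s_j counts the vertices of S in column j, the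
-- alliance condition at the vertices outside S forces
-- 2⌈r/2⌉ ≤ 1 + s_j + s_{j+1} for consecutive columns; summing around the
-- cycle gives t(2⌈r/2⌉ − 1) ≤ 2|S|, which rounds up to the claim.

open import Defs
open import Data.Nat using (ℕ; zero; suc; _+_; _*_; _≤_; _<_; z≤n; s≤s; ⌊_/2⌋; ⌈_/2⌉; _≤?_)
open import Data.Nat.Properties
open import Data.Nat.DivMod using (_%_; m%n<n; m<n⇒m%n≡m; n%n≡0)
open import Data.Fin using (Fin; toℕ; fromℕ; fromℕ<; inject₁; lower₁; _↑ˡ_; _↑ʳ_; combine)
  renaming (zero to fzero; suc to fsuc)
open import Data.Fin.Properties using (toℕ-injective; toℕ-fromℕ<; toℕ-fromℕ; toℕ-inject₁; toℕ<n; inject₁-lower₁; remQuot-combine)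
  renaming (_≟_ to _≟ᶠ_)
open import Data.Bool using (Bool; true; false; _∧_; _∨_; not; T)
open import Data.Bool.Properties using (∧-comm; ∧-assoc; ∨-identityʳ; not-involutive; not-injective; T-∧; T-∨; T-not-≡)
open import Function.Bundles using (Equivalence)
open import Data.Product using (∃; _×_; _,_; proj₁; proj₂)
open import Data.Sum using (_⊎_; inj₁; inj₂)
open import Data.Empty using (⊥-elim)
open import Data.Unit using (tt)
open import Data.Nat.Tactic.RingSolver using (solve-∀)
open import Relation.Nullary.Decidable using (⌊_⌋; yes; no; fromWitness)
open import Relation.Binary.PropositionalEquality
open Equivalence using (to; from)
open import Algebra.Properties.CommutativeMonoid.Sum +-0-commutativeMonoid
  using (sum-syntax; ∑-distrib-+; ∑-comm; sum-cong-≗; sum-init-last)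

-- Counting Boolean predicates on Fin n

𝟙 : Bool → ℕ
𝟙 true  = 1
𝟙 false = 0

count-suc : ∀ {n} (p : Fin (suc n) → Bool) → count p ≡ 𝟙 (p fzero) + count (λ i → p (fsuc i))
count-suc p with p fzero
... | true  = refl
... | false = refl

count≡∑ : ∀ {n} (p : Fin n → Bool) → count p ≡ ∑[ i < n ] 𝟙 (p i)
count≡∑ {zero}  p = refl
count≡∑ {suc n} p = trans (count-suc p) (cong (𝟙 (p fzero) +_) (count≡∑ (λ i → p (fsuc i))))

count-cong : ∀ {n} {p q : Fin n → Bool} → (∀ i → p i ≡ q i) → count p ≡ count q
count-cong {p = p} {q} p≗q =
  trans (count≡∑ p) (trans (sum-cong-≗ (λ i → cong 𝟙 (p≗q i))) (sym (count≡∑ q)))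

count-false : ∀ n → count {n} (λ _ → false) ≡ 0
count-false zero    = refl
count-false (suc n) = count-false n

count-true : ∀ n → count {n} (λ _ → true) ≡ n
count-true zero    = refl
count-true (suc n) = cong suc (count-true n)

𝟙-mono : ∀ {a b} → (T a → T b) → 𝟙 a ≤ 𝟙 b
𝟙-mono {false}         _   = z≤n
𝟙-mono {true}  {true}  _   = ≤-refl
𝟙-mono {true}  {false} a⇒b = ⊥-elim (a⇒b _)

count-mono : ∀ {n} {p q : Fin n → Bool} → (∀ i → T (p i) → T (q i)) → count p ≤ count q
count-mono {zero}          _   = z≤n
count-mono {suc n} {p} {q} p⇒q = begin
  count p                                     ≡⟨ count-suc p ⟩
  𝟙 (p fzero) + count (λ i → p (fsuc i))      ≤⟨ +-mono-≤ (𝟙-mono (p⇒q fzero)) (count-mono (λ i → p⇒q (fsuc i))) ⟩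
  𝟙 (q fzero) + count (λ i → q (fsuc i))      ≡⟨ count-suc q ⟨
  count q                                     ∎
  where open ≤-Reasoning

count-+-cong : ∀ {n} {p q p′ q′ : Fin n → Bool} →
  (∀ i → 𝟙 (p i) + 𝟙 (q i) ≡ 𝟙 (p′ i) + 𝟙 (q′ i)) → count p + count q ≡ count p′ + count q′
count-+-cong {n} {p} {q} {p′} {q′} pointwise = begin
  count p + count q                                ≡⟨ cong₂ _+_ (count≡∑ p) (count≡∑ q) ⟩
  ∑[ i < n ] 𝟙 (p i) + ∑[ i < n ] 𝟙 (q i)          ≡⟨ ∑-distrib-+ (λ i → 𝟙 (p i)) (λ i → 𝟙 (q i)) ⟨
  ∑[ i < n ] (𝟙 (p i) + 𝟙 (q i))                   ≡⟨ sum-cong-≗ pointwise ⟩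
  ∑[ i < n ] (𝟙 (p′ i) + 𝟙 (q′ i))                 ≡⟨ ∑-distrib-+ (λ i → 𝟙 (p′ i)) (λ i → 𝟙 (q′ i)) ⟩
  ∑[ i < n ] 𝟙 (p′ i) + ∑[ i < n ] 𝟙 (q′ i)        ≡⟨ cong₂ _+_ (count≡∑ p′) (count≡∑ q′) ⟨
  count p′ + count q′                              ∎
  where open ≡-Reasoning

count-∨-≤ : ∀ {n} (p q : Fin n → Bool) → count (λ i → p i ∨ q i) ≤ count p + count q
count-∨-≤ p q = subst (count (λ i → p i ∨ q i) ≤_) (count-+-cong (λ i → 𝟙-∨ (p i) (q i)))
                      (m≤m+n _ (count (λ i → p i ∧ q i)))
  where
  𝟙-∨ : ∀ a b → 𝟙 (a ∨ b) + 𝟙 (a ∧ b) ≡ 𝟙 a + 𝟙 b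
  𝟙-∨ true  b     = refl
  𝟙-∨ false true  = refl
  𝟙-∨ false false = refl

count+count-not : ∀ {n} (p : Fin n → Bool) → count p + count (λ i → not (p i)) ≡ n
count+count-not {n} p = begin
  count p + count (λ i → not (p i))                 ≡⟨ count-+-cong {p′ = λ _ → true} {q′ = λ _ → false} (λ i → 𝟙-not (p i)) ⟩
  count {n} (λ _ → true) + count {n} (λ _ → false)  ≡⟨ cong₂ _+_ (count-true n) (count-false n) ⟩
  n + 0                                             ≡⟨ +-identityʳ n ⟩
  n                                                 ∎
  where
  open ≡-Reasoning
  𝟙-not : ∀ a → 𝟙 a + 𝟙 (not a) ≡ 𝟙 true + 𝟙 false
  𝟙-not true  = refl
  𝟙-not false = refl

⌊fsuc≟fsuc⌋ : ∀ {n} (a i : Fin n) → ⌊ fsuc a ≟ᶠ fsuc i ⌋ ≡ ⌊ a ≟ᶠ i ⌋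
⌊fsuc≟fsuc⌋ a i with a ≟ᶠ i
... | yes _ = refl
... | no  _ = refl

count-point : ∀ {n} (a : Fin n) (p : Fin n → Bool) → count (λ i → ⌊ a ≟ᶠ i ⌋ ∧ p i) ≡ 𝟙 (p a)
count-point {suc n} fzero    p = trans (count-suc (λ i → ⌊ fzero ≟ᶠ i ⌋ ∧ p i))
  (trans (cong (𝟙 (p fzero) +_) (count-false n)) (+-identityʳ _))
count-point {suc n} (fsuc a) p = trans (count-suc (λ i → ⌊ fsuc a ≟ᶠ i ⌋ ∧ p i))
  (trans (count-cong (λ i → cong (_∧ p (fsuc i)) (⌊fsuc≟fsuc⌋ a i))) (count-point a (λ i → p (fsuc i))))

𝟙≤count : ∀ {n} (p : Fin n → Bool) (a : Fin n) → 𝟙 (p a) ≤ count p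
𝟙≤count p a = subst (_≤ count p) (count-point a p)
  (count-mono {p = λ i → ⌊ a ≟ᶠ i ⌋ ∧ p i} (λ i h → proj₂ (T-∧ {⌊ a ≟ᶠ i ⌋} .to h)))

count-witness : ∀ {n} (p : Fin n → Bool) → count p ≡ 0 ⊎ ∃ λ i → T (p i)
count-witness {zero}  p = inj₁ refl
count-witness {suc n} p with p fzero in p0
... | true  = inj₂ (fzero , subst T (sym p0) _)
... | false with count-witness (λ i → p (fsuc i))
...   | inj₁ none     = inj₁ none
...   | inj₂ (i , pi) = inj₂ (fsuc i , pi)

count-↑ : ∀ m n (g : Fin (m + n) → Bool) → count g ≡ count (λ i → g (i ↑ˡ n)) + count (λ i → g (m ↑ʳ i))
count-↑ zero    n g = refl
count-↑ (suc m) n g = begin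
  count g                                                                     ≡⟨ count-suc g ⟩
  𝟙 (g fzero) + count (λ i → g (fsuc i))                                       ≡⟨ cong (𝟙 (g fzero) +_) (count-↑ m n (λ i → g (fsuc i))) ⟩
  𝟙 (g fzero) + (count (λ i → g (fsuc (i ↑ˡ n))) + count (λ i → g (suc m ↑ʳ i))) ≡⟨ +-assoc (𝟙 (g fzero)) _ _ ⟨
  (𝟙 (g fzero) + count (λ i → g (fsuc (i ↑ˡ n)))) + count (λ i → g (suc m ↑ʳ i)) ≡⟨ cong (_+ count (λ i → g (suc m ↑ʳ i))) (count-suc (λ i → g (i ↑ˡ n))) ⟨
  count (λ i → g (i ↑ˡ n)) + count (λ i → g (suc m ↑ʳ i))                       ∎
  where open ≡-Reasoning

count-combine : ∀ m n (g : Fin (m * n) → Bool) → count g ≡ ∑[ a < m ] count {n} (λ d → g (combine a d))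
count-combine zero    n g = refl
count-combine (suc m) n g =
  trans (count-↑ n (m * n) g) (cong (count (λ d → g (d ↑ˡ (m * n))) +_) (count-combine m n (λ i → g (n ↑ʳ i))))

∑-count-comm : ∀ m n (P : Fin m → Fin n → Bool) →
  ∑[ a < m ] count (P a) ≡ ∑[ d < n ] count (λ a → P a d)
∑-count-comm m n P = begin
  ∑[ a < m ] count (P a)                      ≡⟨ sum-cong-≗ (λ a → count≡∑ (P a)) ⟩
  ∑[ a < m ] ∑[ d < n ] 𝟙 (P a d)              ≡⟨ ∑-comm (λ a d → 𝟙 (P a d)) ⟩
  ∑[ d < n ] ∑[ a < m ] 𝟙 (P a d)              ≡⟨ sum-cong-≗ (λ d → count≡∑ (λ a → P a d)) ⟨
  ∑[ d < n ] count (λ a → P a d)              ∎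
  where open ≡-Reasoning

∑-const : ∀ n k → ∑[ i < n ] k ≡ n * k
∑-const zero    k = refl
∑-const (suc n) k = cong (k +_) (∑-const n k)

∑-mono-≤ : ∀ {n} {f g : Fin n → ℕ} → (∀ i → f i ≤ g i) → ∑[ i < n ] f i ≤ ∑[ i < n ] g i
∑-mono-≤ {zero}  f≤g = z≤n
∑-mono-≤ {suc n} f≤g = +-mono-≤ (f≤g fzero) (∑-mono-≤ (λ i → f≤g (fsuc i)))

m+m≤1+[n+n]⇒m≤n : ∀ {m n} → m + m ≤ suc (n + n) → m ≤ n
m+m≤1+[n+n]⇒m≤n {m} {n} h = subst₂ _≤_ (sym (n≡⌊n+n/2⌋ m)) (sym (n≡⌈n+n/2⌉ n)) (⌊n/2⌋-mono h)

n≤m+m⇒⌈n/2⌉≤m : ∀ {m n} → n ≤ m + m → ⌈ n /2⌉ ≤ m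
n≤m+m⇒⌈n/2⌉≤m {m} {n} h = subst (⌈ n /2⌉ ≤_) (sym (n≡⌈n+n/2⌉ m)) (⌈n/2⌉-mono h)

n≤⌈n/2⌉+⌈n/2⌉ : ∀ n → n ≤ ⌈ n /2⌉ + ⌈ n /2⌉
n≤⌈n/2⌉+⌈n/2⌉ n = subst (_≤ ⌈ n /2⌉ + ⌈ n /2⌉) (⌊n/2⌋+⌈n/2⌉≡n n) (+-monoˡ-≤ ⌈ n /2⌉ (⌊n/2⌋≤⌈n/2⌉ n))

⌊n/2⌋+⌊n/2⌋≤n : ∀ n → ⌊ n /2⌋ + ⌊ n /2⌋ ≤ n
⌊n/2⌋+⌊n/2⌋≤n n = subst (⌊ n /2⌋ + ⌊ n /2⌋ ≤_) (⌊n/2⌋+⌈n/2⌉≡n n) (+-monoʳ-≤ ⌊ n /2⌋ (⌊n/2⌋≤⌈n/2⌉ n))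

⌈n/2⌉+⌈n/2⌉≤1+n : ∀ n → ⌈ n /2⌉ + ⌈ n /2⌉ ≤ suc n
⌈n/2⌉+⌈n/2⌉≤1+n n =
  subst (⌈ n /2⌉ + ⌈ n /2⌉ ≤_) (cong suc (⌊n/2⌋+⌈n/2⌉≡n n)) (+-monoˡ-≤ ⌈ n /2⌉ (⌊n/2⌋-mono (n≤1+n (suc n))))

-- From t ≥ 2⌈t/2⌉ − 1 the hypothesis gives (2⌈t/2⌉ − 1)(2q − 1) ≤ 2c,
-- and 2q⌈t/2⌉ exceeds the left-hand side by at most one.
t*[q+q]≤t+[c+c]⇒q*⌈t/2⌉≤c : ∀ {q t c} → t * (q + q) ≤ t + (c + c) → q * ⌈ t /2⌉ ≤ c
t*[q+q]≤t+[c+c]⇒q*⌈t/2⌉≤c {zero}            _ = z≤n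
t*[q+q]≤t+[c+c]⇒q*⌈t/2⌉≤c {suc q} {zero} {c} _ = subst (_≤ c) (sym (*-zeroʳ (suc q))) z≤n
t*[q+q]≤t+[c+c]⇒q*⌈t/2⌉≤c {suc q} {suc t} {c} h = m+m≤1+[n+n]⇒m≤n (begin
  suc q * suc u + suc q * suc u               ≤⟨ m≤n+m _ (q * u + q * u) ⟩
  (q * u + q * u) + (suc q * suc u + suc q * suc u) ≡⟨ parity-gap q u ⟨
  suc (suc (u + u) * suc (q + q))             ≤⟨ s≤s (*-monoˡ-≤ (suc (q + q)) (s≤s (⌊n/2⌋+⌊n/2⌋≤n t))) ⟩
  suc (suc t * suc (q + q))                   ≤⟨ s≤s (+-cancelˡ-≤ (suc t) _ _ (subst (_≤ suc t + (c + c)) (split (suc t) q) h)) ⟩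
  suc (c + c)                                 ∎)
  where
  open ≤-Reasoning
  u = ⌊ t /2⌋
  split : ∀ t q → t * (suc q + suc q) ≡ t + t * suc (q + q)
  split = solve-∀
  parity-gap : ∀ q u → suc (suc (u + u) * suc (q + q)) ≡ (q * u + q * u) + (suc q * suc u + suc q * suc u)
  parity-gap = solve-∀

-- Cartesian products

module _ (G H : Graph) where

  adj-□-combine : ∀ a b c d → adj (G □ H) (combine a b) (combine c d) ≡ (⌊ a ≟ᶠ c ⌋ ∧ adj H b d) ∨ (adj G a c ∧ ⌊ b ≟ᶠ d ⌋)
  adj-□-combine a b c d = cong₂ adj-pairs (remQuot-combine {n G} {n H} a b) (remQuot-combine {n G} {n H} c d)
    where
    adj-pairs : Fin (n G) × Fin (n H) → Fin (n G) × Fin (n H) → Bool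
    adj-pairs (a , b) (c , d) = (⌊ a ≟ᶠ c ⌋ ∧ adj H b d) ∨ (adj G a c ∧ ⌊ b ≟ᶠ d ⌋)

  ∑-count-point : ∀ {m} (a : Fin m) (Y : Fin (n H) → Bool) → ∑[ c < m ] count (λ d → ⌊ a ≟ᶠ c ⌋ ∧ Y d) ≡ count Y
  ∑-count-point {m} a Y = begin
    ∑[ c < m ] count (λ d → ⌊ a ≟ᶠ c ⌋ ∧ Y d)    ≡⟨ ∑-count-comm m (n H) (λ c d → ⌊ a ≟ᶠ c ⌋ ∧ Y d) ⟩
    ∑[ d < n H ] count (λ c → ⌊ a ≟ᶠ c ⌋ ∧ Y d)  ≡⟨ sum-cong-≗ (λ d → count-point a (λ _ → Y d)) ⟩
    ∑[ d < n H ] 𝟙 (Y d)                        ≡⟨ count≡∑ Y ⟨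
    count Y                                     ∎
    where open ≡-Reasoning

  -- Without loops in G the two kinds of edges of G □ H are disjoint.
  deg-in-□ : (∀ a → adj G a a ≡ false) → ∀ (S : Subset (n G * n H)) a b →
    deg-in (G □ H) S (combine a b) ≡ deg-in G (λ c → S (combine c b)) a + deg-in H (λ d → S (combine a d)) b
  deg-in-□ loopless S a b = begin
    deg-in (G □ H) S (combine a b)
      ≡⟨ count-combine (n G) (n H) _ ⟩
    ∑[ c < n G ] count (λ d → adj (G □ H) (combine a b) (combine c d) ∧ S (combine c d))
      ≡⟨ sum-cong-≗ (λ c → count-cong (λ d → cong (_∧ S (combine c d)) (adj-□-combine a b c d))) ⟩
    ∑[ c < n G ] count (λ d → ((⌊ a ≟ᶠ c ⌋ ∧ adj H b d) ∨ (adj G a c ∧ ⌊ b ≟ᶠ d ⌋)) ∧ S (combine c d))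
      ≡⟨ sum-cong-≗ split-row ⟩
    ∑[ c < n G ] (𝟙 (adj G a c ∧ S (combine c b)) + count (λ d → ⌊ a ≟ᶠ c ⌋ ∧ (adj H b d ∧ S (combine a d))))
      ≡⟨ ∑-distrib-+ (λ c → 𝟙 (adj G a c ∧ S (combine c b))) _ ⟩
    ∑[ c < n G ] 𝟙 (adj G a c ∧ S (combine c b)) + ∑[ c < n G ] count (λ d → ⌊ a ≟ᶠ c ⌋ ∧ (adj H b d ∧ S (combine a d)))
      ≡⟨ cong₂ _+_ (sym (count≡∑ (λ c → adj G a c ∧ S (combine c b)))) (∑-count-point a (λ d → adj H b d ∧ S (combine a d))) ⟩
    deg-in G (λ c → S (combine c b)) a + deg-in H (λ d → S (combine a d)) b
      ∎
    where
    open ≡-Reasoning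
    split-row : ∀ c → count (λ d → ((⌊ a ≟ᶠ c ⌋ ∧ adj H b d) ∨ (adj G a c ∧ ⌊ b ≟ᶠ d ⌋)) ∧ S (combine c d))
                    ≡ 𝟙 (adj G a c ∧ S (combine c b)) + count (λ d → ⌊ a ≟ᶠ c ⌋ ∧ (adj H b d ∧ S (combine a d)))
    split-row c with a ≟ᶠ c
    ... | yes refl rewrite loopless a = count-cong (λ d → cong (_∧ S (combine a d)) (∨-identityʳ (adj H b d)))
    ... | no  _    = begin
      count (λ d → (adj G a c ∧ ⌊ b ≟ᶠ d ⌋) ∧ S (combine c d))    ≡⟨ count-cong (λ d → ∧-swapˡ (adj G a c) ⌊ b ≟ᶠ d ⌋ (S (combine c d))) ⟩
      count (λ d → ⌊ b ≟ᶠ d ⌋ ∧ (adj G a c ∧ S (combine c d)))    ≡⟨ count-point b (λ d → adj G a c ∧ S (combine c d)) ⟩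
      𝟙 (adj G a c ∧ S (combine c b))                            ≡⟨ +-identityʳ _ ⟨
      𝟙 (adj G a c ∧ S (combine c b)) + 0                        ≡⟨ cong (𝟙 (adj G a c ∧ S (combine c b)) +_) (count-false (n H)) ⟨
      𝟙 (adj G a c ∧ S (combine c b)) + count {n H} (λ _ → false) ∎
      where
      ∧-swapˡ : ∀ x y z → (x ∧ y) ∧ z ≡ y ∧ (x ∧ z)
      ∧-swapˡ x y z = trans (cong (_∧ z) (∧-comm x y)) (∧-assoc y x z)

-- Complete graphs

K-loopless : ∀ {r} (a : Fin r) → adj (K r) a a ≡ false
K-loopless a with a ≟ᶠ a
... | yes _  = refl
... | no a≢a = ⊥-elim (a≢a refl)

deg-in-K : ∀ {r} (X : Subset r) a → 𝟙 (X a) + deg-in (K r) X a ≡ card X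
deg-in-K {r} X a = begin
  𝟙 (X a) + count (λ u → neq a u ∧ X u)                               ≡⟨ cong (_+ count (λ u → neq a u ∧ X u)) (count-point a X) ⟨
  count (λ u → ⌊ a ≟ᶠ u ⌋ ∧ X u) + count (λ u → neq a u ∧ X u)        ≡⟨ count-+-cong {p′ = X} {q′ = λ _ → false} (λ u → 𝟙-split ⌊ a ≟ᶠ u ⌋ (X u)) ⟩
  count X + count {r} (λ _ → false)                                   ≡⟨ cong (count X +_) (count-false r) ⟩
  count X + 0                                                         ≡⟨ +-identityʳ (count X) ⟩
  count X                                                             ∎
  where
  open ≡-Reasoning
  𝟙-split : ∀ x y → 𝟙 (x ∧ y) + 𝟙 (not x ∧ y) ≡ 𝟙 y + 𝟙 false
  𝟙-split true  true  = refl
  𝟙-split true  false = refl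
  𝟙-split false true  = refl
  𝟙-split false false = refl

K-alliance : ∀ {r} (X : Subset r) → 1 ≤ card X → r ≤ card X + card X → IsGlobalOffensiveAlliance (K r) X
K-alliance {r} X X≢∅ r≤2∣X∣ = X≢∅ , λ v v∉X → begin
  deg-in (K r) (compl X) v + 1              ≡⟨ +-comm _ 1 ⟩
  1 + deg-in (K r) (compl X) v              ≡⟨ cong (λ b → 𝟙 (not b) + deg-in (K r) (compl X) v) v∉X ⟨
  𝟙 (compl X v) + deg-in (K r) (compl X) v  ≡⟨ deg-in-K (compl X) v ⟩
  card (compl X)                            ≤⟨ +-cancelˡ-≤ (card X) _ _ (subst (_≤ card X + card X) (sym (count+count-not X)) r≤2∣X∣) ⟩
  card X                                    ≡⟨ deg-in-K X v ⟨
  𝟙 (X v) + deg-in (K r) X v                ≡⟨ cong (λ b → 𝟙 b + deg-in (K r) X v) v∉X ⟩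
  deg-in (K r) X v                          ∎
  where open ≤-Reasoning

initialSegment : ∀ {n} → ℕ → Subset n
initialSegment zero    _        = false
initialSegment (suc k) fzero    = true
initialSegment (suc k) (fsuc i) = initialSegment k i

card-initialSegment : ∀ {n} k → k ≤ n → card {n} (initialSegment k) ≡ k
card-initialSegment {zero}  zero    z≤n     = refl
card-initialSegment {suc n} zero    z≤n     = card-initialSegment {n} zero z≤n
card-initialSegment {suc n} (suc k) (s≤s k≤n) = cong suc (card-initialSegment k k≤n)

γₒ[K]≤⌈r/2⌉ : ∀ {r k} → 1 ≤ r → IsGammaO (K r) k → k ≤ ⌈ r /2⌉
γₒ[K]≤⌈r/2⌉ {r} {k} r≥1 (_ , minimal) = subst (k ≤_) ∣Q∣≡q (minimal Q Q-alliance)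
  where
  Q = initialSegment ⌈ r /2⌉
  ∣Q∣≡q : card Q ≡ ⌈ r /2⌉
  ∣Q∣≡q = card-initialSegment ⌈ r /2⌉ (⌈n/2⌉≤n r)
  Q-alliance : IsGlobalOffensiveAlliance (K r) Q
  Q-alliance = K-alliance Q (subst (1 ≤_) (sym ∣Q∣≡q) (⌈n/2⌉-mono r≥1))
                            (subst (λ m → r ≤ m + m) (sym ∣Q∣≡q) (n≤⌈n/2⌉+⌈n/2⌉ r))

-- Cycles

isEven : ℕ → Bool
isEven zero    = true
isEven (suc n) = not (isEven n)

count-isEven : ∀ n → count {n} (λ i → isEven (toℕ i)) ≡ ⌈ n /2⌉ × count {n} (λ i → not (isEven (toℕ i))) ≡ ⌊ n /2⌋
count-isEven zero    = refl , refl
count-isEven (suc n) = cong suc (proj₂ (count-isEven n)) ,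
                       trans (count-cong {n} (λ i → not-involutive (isEven (toℕ i)))) (proj₁ (count-isEven n))

module _ {t₀ : ℕ} where

  next : Fin (suc t₀) → Fin (suc t₀)
  next j = fromℕ< (m%n<n (suc (toℕ j)) (suc t₀))

  prev : Fin (suc t₀) → Fin (suc t₀)
  prev fzero    = fromℕ t₀
  prev (fsuc i) = inject₁ i

  toℕ-next : ∀ j → toℕ (next j) ≡ suc (toℕ j) % suc t₀
  toℕ-next j = toℕ-fromℕ< (m%n<n (suc (toℕ j)) (suc t₀))

  next-inject₁ : ∀ i → next (inject₁ i) ≡ fsuc i
  next-inject₁ i = toℕ-injective (begin
    toℕ (next (inject₁ i))        ≡⟨ toℕ-next (inject₁ i) ⟩
    suc (toℕ (inject₁ i)) % suc t₀ ≡⟨ cong (λ k → suc k % suc t₀) (toℕ-inject₁ i) ⟩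
    suc (toℕ i) % suc t₀           ≡⟨ m<n⇒m%n≡m (s≤s (toℕ<n i)) ⟩
    suc (toℕ i)                    ∎)
    where open ≡-Reasoning

  next-fromℕ : next (fromℕ t₀) ≡ fzero
  next-fromℕ = toℕ-injective (begin
    toℕ (next (fromℕ t₀))         ≡⟨ toℕ-next (fromℕ t₀) ⟩
    suc (toℕ (fromℕ t₀)) % suc t₀  ≡⟨ cong (λ k → suc k % suc t₀) (toℕ-fromℕ t₀) ⟩
    suc t₀ % suc t₀                ≡⟨ n%n≡0 (suc t₀) ⟩
    0                              ∎)
    where open ≡-Reasoning

  fromℕ-or-inject₁ : ∀ (j : Fin (suc t₀)) → j ≡ fromℕ t₀ ⊎ ∃ λ i → j ≡ inject₁ i
  fromℕ-or-inject₁ j with t₀ ≟ toℕ j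
  ... | yes t₀≡j = inj₁ (toℕ-injective (trans (sym t₀≡j) (sym (toℕ-fromℕ t₀))))
  ... | no  t₀≢j = inj₂ (lower₁ j t₀≢j , sym (inject₁-lower₁ j t₀≢j))

  next-prev : ∀ j → next (prev j) ≡ j
  next-prev fzero    = next-fromℕ
  next-prev (fsuc i) = next-inject₁ i

  prev-next : ∀ j → prev (next j) ≡ j
  prev-next j with fromℕ-or-inject₁ j
  ... | inj₁ refl       = cong prev next-fromℕ
  ... | inj₂ (i , refl) = cong prev (next-inject₁ i)

  ∑-rotate : ∀ (f : Fin (suc t₀) → ℕ) → ∑[ j < suc t₀ ] f (next j) ≡ ∑[ j < suc t₀ ] f j
  ∑-rotate f = begin
    ∑[ j < suc t₀ ] f (next j)                            ≡⟨ sum-init-last (λ j → f (next j)) ⟩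
    ∑[ i < t₀ ] f (next (inject₁ i)) + f (next (fromℕ t₀)) ≡⟨ cong₂ _+_ (sum-cong-≗ (λ i → cong f (next-inject₁ i))) (cong f next-fromℕ) ⟩
    ∑[ i < t₀ ] f (fsuc i) + f fzero                      ≡⟨ +-comm _ (f fzero) ⟩
    ∑[ j < suc t₀ ] f j                                   ∎
    where open ≡-Reasoning

  toℕ-next-suc⊎zero : ∀ j → toℕ (next j) ≡ suc (toℕ j) ⊎ next j ≡ fzero
  toℕ-next-suc⊎zero j with fromℕ-or-inject₁ j
  ... | inj₁ refl       = inj₂ next-fromℕ
  ... | inj₂ (i , refl) = inj₁ (trans (cong toℕ (next-inject₁ i)) (cong suc (sym (toℕ-inject₁ i))))

  cycAdj-next : ∀ j → cycAdj (suc t₀) j (next j) ≡ true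
  cycAdj-next j with toℕ (next j) ≟ suc (toℕ j) % suc t₀
  ... | yes _            = refl
  ... | no  ≢suc%        = ⊥-elim (≢suc% (toℕ-next j))

  cycAdj-prev : ∀ j → cycAdj (suc t₀) j (prev j) ≡ true
  cycAdj-prev j with toℕ (prev j) ≟ suc (toℕ j) % suc t₀ | toℕ j ≟ suc (toℕ (prev j)) % suc t₀
  ... | yes _ | _      = refl
  ... | no  _ | yes _  = refl
  ... | no  _ | no ≢suc% = ⊥-elim (≢suc% (trans (cong toℕ (sym (next-prev j))) (toℕ-next (prev j))))

  cycAdj⇒next⊎prev : ∀ j d → T (cycAdj (suc t₀) j d) → d ≡ next j ⊎ d ≡ prev j
  cycAdj⇒next⊎prev j d adj-jd with toℕ d ≟ suc (toℕ j) % suc t₀ | toℕ j ≟ suc (toℕ d) % suc t₀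
  ... | yes d≡ | _     = inj₁ (toℕ-injective (trans d≡ (sym (toℕ-next j))))
  ... | no  _  | yes j≡ = inj₂ (trans (sym (prev-next d)) (cong prev (toℕ-injective (trans (toℕ-next d) (sym j≡)))))
  ... | no  _  | no  _  = ⊥-elim adj-jd

  deg-in-C-≤ : ∀ (R : Subset (suc t₀)) j → deg-in (C (suc t₀)) R j ≤ 𝟙 (R (next j)) + 1
  deg-in-C-≤ R j = begin
    deg-in (C (suc t₀)) R j
      ≤⟨ count-mono neighbour ⟩
    count (λ d → (⌊ next j ≟ᶠ d ⌋ ∧ R d) ∨ (⌊ prev j ≟ᶠ d ⌋ ∧ true))
      ≤⟨ count-∨-≤ (λ d → ⌊ next j ≟ᶠ d ⌋ ∧ R d) (λ d → ⌊ prev j ≟ᶠ d ⌋ ∧ true) ⟩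
    count (λ d → ⌊ next j ≟ᶠ d ⌋ ∧ R d) + count (λ d → ⌊ prev j ≟ᶠ d ⌋ ∧ true)
      ≡⟨ cong₂ _+_ (count-point (next j) R) (count-point (prev j) (λ _ → true)) ⟩
    𝟙 (R (next j)) + 1
      ∎
    where
    open ≤-Reasoning
    neighbour : ∀ d → T (cycAdj (suc t₀) j d ∧ R d) → T ((⌊ next j ≟ᶠ d ⌋ ∧ R d) ∨ (⌊ prev j ≟ᶠ d ⌋ ∧ true))
    neighbour d h with T-∧ .to h
    ... | adj-jd , Rd with cycAdj⇒next⊎prev j d adj-jd
    ...   | inj₁ refl = T-∨ {⌊ next j ≟ᶠ d ⌋ ∧ R d} .from (inj₁ (T-∧ {⌊ next j ≟ᶠ d ⌋} .from (fromWitness refl , Rd)))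
    ...   | inj₂ refl = T-∨ {⌊ next j ≟ᶠ d ⌋ ∧ R d} .from (inj₂ (T-∧ {⌊ prev j ≟ᶠ d ⌋} .from (fromWitness refl , _)))

  deg-in-C-≥ : ∀ (R : Subset (suc t₀)) j → 𝟙 (R (next j)) ≤ deg-in (C (suc t₀)) R j
  deg-in-C-≥ R j = subst (_≤ deg-in (C (suc t₀)) R j) (cong (λ b → 𝟙 (b ∧ R (next j))) (cycAdj-next j))
                         (𝟙≤count (λ d → cycAdj (suc t₀) j d ∧ R d) (next j))

  evenPositions : Subset (suc t₀)
  evenPositions j = isEven (toℕ j)

  isEven-next : ∀ (j : Fin (suc t₀)) → isEven (toℕ j) ≡ false → isEven (toℕ (next j)) ≡ true
  isEven-next j odd with toℕ-next-suc⊎zero j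
  ... | inj₁ next≡suc = trans (cong isEven next≡suc) (cong not odd)
  ... | inj₂ next≡0   = cong (λ k → isEven (toℕ k)) next≡0

  isEven-prev : ∀ (j : Fin (suc t₀)) → isEven (toℕ j) ≡ false → isEven (toℕ (prev j)) ≡ true
  isEven-prev j odd with toℕ-next-suc⊎zero (prev j)
  ... | inj₁ next≡suc = not-injective (trans (sym (cong isEven j≡suc)) odd)
    where
    j≡suc : toℕ j ≡ suc (toℕ (prev j))
    j≡suc = trans (cong toℕ (sym (next-prev j))) next≡suc
  ... | inj₂ next≡0   with trans (sym odd) (cong (λ k → isEven (toℕ k)) (trans (sym (next-prev j)) next≡0))
  ...   | ()

  evenPositions-alliance : IsGlobalOffensiveAlliance (C (suc t₀)) evenPositions
  evenPositions-alliance = s≤s z≤n , λ v odd → begin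
    deg-in (C (suc t₀)) (compl evenPositions) v + 1          ≡⟨ cong (_+ 1) (n≤0⇒n≡0 (no-odd-neighbour v odd)) ⟩
    1                                                        ≡⟨ cong₂ (λ a b → 𝟙 (a ∧ b)) (cycAdj-prev v) (isEven-prev v odd) ⟨
    𝟙 (cycAdj (suc t₀) v (prev v) ∧ evenPositions (prev v))  ≤⟨ 𝟙≤count (λ u → cycAdj (suc t₀) v u ∧ evenPositions u) (prev v) ⟩
    deg-in (C (suc t₀)) evenPositions v                      ∎
    where
    open ≤-Reasoning
    no-odd-neighbour : ∀ (v : Fin (suc t₀)) → isEven (toℕ v) ≡ false → deg-in (C (suc t₀)) (compl evenPositions) v ≤ 0
    no-odd-neighbour v odd = subst (deg-in (C (suc t₀)) (compl evenPositions) v ≤_) (count-false (suc t₀)) (count-mono {q = λ _ → false} odd-neighbour)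
      where
      odd-neighbour : ∀ u → T (cycAdj (suc t₀) v u ∧ not (isEven (toℕ u))) → T false
      odd-neighbour u h with T-∧ {cycAdj (suc t₀) v u} .to h
      ... | adj-vu , u-odd with cycAdj⇒next⊎prev v u adj-vu
      ...   | inj₁ refl = subst (λ b → T (not b)) (isEven-next v odd) u-odd
      ...   | inj₂ refl = subst (λ b → T (not b)) (isEven-prev v odd) u-odd

γₒ[C]≤⌈t/2⌉ : ∀ {t₀ k} → IsGammaO (C (suc t₀)) k → k ≤ ⌈ suc t₀ /2⌉
γₒ[C]≤⌈t/2⌉ {t₀} {k} (_ , minimal) =
  subst (k ≤_) (proj₁ (count-isEven (suc t₀))) (minimal evenPositions evenPositions-alliance)

-- Global offensive alliances of K_r □ C_t

module _ {r t₀ : ℕ} (S : Subset (r * suc t₀)) (S-alliance : IsGlobalOffensiveAlliance (K r □ C (suc t₀)) S) where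

  column : Fin (suc t₀) → Subset r
  column j a = S (combine a j)

  inside outside : Fin (suc t₀) → ℕ
  inside  j = card (column j)
  outside j = card (compl (column j))

  column-inequality : ∀ a j → S (combine a j) ≡ false →
    outside j + 𝟙 (not (S (combine a (next j)))) ≤ inside j + (𝟙 (S (combine a (next j))) + 1)
  column-inequality a j v∉S = begin
    outside j + 𝟙 (not (S p))              ≤⟨ +-monoʳ-≤ (outside j) (deg-in-C-≥ (λ d → not (S (combine a d))) j) ⟩
    outside j + D̄C                         ≡⟨ cong (_+ D̄C) (deg-in-K (compl (column j)) a) ⟨
    𝟙 (not (S v)) + D̄K + D̄C                ≡⟨ cong (λ b → 𝟙 (not b) + D̄K + D̄C) v∉S ⟩
    suc (D̄K + D̄C)                          ≡⟨ cong suc (deg-in-□ (K r) (C (suc t₀)) K-loopless (compl S) a j) ⟨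
    suc (deg-in G (compl S) v)             ≡⟨ +-comm 1 _ ⟩
    deg-in G (compl S) v + 1               ≤⟨ proj₂ S-alliance v v∉S ⟩
    deg-in G S v                           ≡⟨ deg-in-□ (K r) (C (suc t₀)) K-loopless S a j ⟩
    DK + DC                                ≡⟨ cong (λ b → 𝟙 b + DK + DC) v∉S ⟨
    𝟙 (S v) + DK + DC                      ≡⟨ cong (_+ DC) (deg-in-K (column j) a) ⟩
    inside j + DC                          ≤⟨ +-monoʳ-≤ (inside j) (deg-in-C-≤ (λ d → S (combine a d)) j) ⟩
    inside j + (𝟙 (S p) + 1)               ∎
    where
    open ≤-Reasoning
    G = K r □ C (suc t₀)
    v = combine a j
    p = combine a (next j)
    DK D̄K DC D̄C : ℕ
    DK = deg-in (K r) (column j) a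
    D̄K = deg-in (K r) (compl (column j)) a
    DC = deg-in (C (suc t₀)) (λ d → S (combine a d)) j
    D̄C = deg-in (C (suc t₀)) (λ d → not (S (combine a d))) j

  column-inequality-next∈S : ∀ a j → S (combine a j) ≡ false → S (combine a (next j)) ≡ true → outside j ≤ inside j + 2
  column-inequality-next∈S a j v∉S p∈S = subst (_≤ inside j + 2) (+-identityʳ (outside j))
    (subst (λ b → outside j + 𝟙 (not b) ≤ inside j + (𝟙 b + 1)) p∈S (column-inequality a j v∉S))

  column-inequality-next∉S : ∀ a j → S (combine a j) ≡ false → S (combine a (next j)) ≡ false → outside j ≤ inside j
  column-inequality-next∉S a j v∉S p∉S = +-cancelʳ-≤ 1 (outside j) (inside j)
    (subst (λ b → outside j + 𝟙 (not b) ≤ inside j + (𝟙 b + 1)) p∉S (column-inequality a j v∉S))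

  outside≤inside+2 : ∀ j → outside j ≤ inside j + 2
  outside≤inside+2 j with count-witness (compl (column j))
  ... | inj₁ none          = subst (_≤ inside j + 2) (sym none) z≤n
  ... | inj₂ (a , v∉S) with S (combine a (next j)) in p∈?S
  ...   | true  = column-inequality-next∈S a j (T-not-≡ .to v∉S) p∈?S
  ...   | false = ≤-trans (column-inequality-next∉S a j (T-not-≡ .to v∉S) p∈?S) (m≤m+n (inside j) 2)

  outside≤inside∘next : ∀ j → inside j < outside j → outside j ≤ inside (next j)
  outside≤inside∘next j in<out = count-mono shifted
    where
    shifted : ∀ (a : Fin r) → T (not (S (combine a j))) → T (S (combine a (next j)))
    shifted a v∉S with S (combine a (next j)) in p∈?S
    ... | true  = tt
    ... | false = ⊥-elim (<⇒≱ in<out (column-inequality-next∉S a j (T-not-≡ .to v∉S) p∈?S))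

  -- Either column j is at least half in S (and then column next j nearly so),
  -- or most of it lies outside S, and the successors of those vertices are in S.
  ⌈r/2⌉+⌈r/2⌉≤1+inside+inside∘next : ∀ j → ⌈ r /2⌉ + ⌈ r /2⌉ ≤ 1 + (inside j + inside (next j))
  ⌈r/2⌉+⌈r/2⌉≤1+inside+inside∘next j with outside j ≤? inside j
  ... | yes out≤in = subst (⌈ r /2⌉ + ⌈ r /2⌉ ≤_) (+-suc (inside j) (inside (next j))) (+-mono-≤ q≤in q≤in′+1)
    where
    q≤in : ⌈ r /2⌉ ≤ inside j
    q≤in = n≤m+m⇒⌈n/2⌉≤m (subst (_≤ inside j + inside j) (count+count-not (column j)) (+-monoʳ-≤ (inside j) out≤in))
    q≤in′+1 : ⌈ r /2⌉ ≤ suc (inside (next j))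
    q≤in′+1 = n≤m+m⇒⌈n/2⌉≤m (begin
      r                                      ≡⟨ count+count-not (column (next j)) ⟨
      inside (next j) + outside (next j)     ≤⟨ +-monoʳ-≤ (inside (next j)) (outside≤inside+2 (next j)) ⟩
      inside (next j) + (inside (next j) + 2) ≡⟨ double-suc (inside (next j)) ⟩
      suc (inside (next j)) + suc (inside (next j)) ∎)
      where
      open ≤-Reasoning
      double-suc : ∀ m → m + (m + 2) ≡ suc m + suc m
      double-suc = solve-∀
  ... | no out≰in = ≤-trans (⌈n/2⌉+⌈n/2⌉≤1+n r)
    (s≤s (subst (_≤ inside j + inside (next j)) (count+count-not (column j))
                (+-monoʳ-≤ (inside j) (outside≤inside∘next j (≰⇒> out≰in)))))

  card≡∑inside : card S ≡ ∑[ j < suc t₀ ] inside j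
  card≡∑inside = trans (count-combine r (suc t₀) S) (∑-count-comm r (suc t₀) (λ a d → S (combine a d)))

  t*[⌈r/2⌉+⌈r/2⌉]≤t+[∣S∣+∣S∣] : suc t₀ * (⌈ r /2⌉ + ⌈ r /2⌉) ≤ suc t₀ + (card S + card S)
  t*[⌈r/2⌉+⌈r/2⌉]≤t+[∣S∣+∣S∣] = begin
    suc t₀ * (⌈ r /2⌉ + ⌈ r /2⌉)                             ≡⟨ ∑-const (suc t₀) _ ⟨
    ∑[ j < suc t₀ ] (⌈ r /2⌉ + ⌈ r /2⌉)                      ≤⟨ ∑-mono-≤ ⌈r/2⌉+⌈r/2⌉≤1+inside+inside∘next ⟩
    ∑[ j < suc t₀ ] (1 + (inside j + inside (next j)))       ≡⟨ ∑-distrib-+ (λ _ → 1) (λ j → inside j + inside (next j)) ⟩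
    ∑[ j < suc t₀ ] 1 + ∑[ j < suc t₀ ] (inside j + inside (next j))
                                                             ≡⟨ cong₂ _+_ (trans (∑-const (suc t₀) 1) (*-identityʳ (suc t₀))) (∑-distrib-+ inside (λ j → inside (next j))) ⟩
    suc t₀ + (∑[ j < suc t₀ ] inside j + ∑[ j < suc t₀ ] inside (next j))
                                                             ≡⟨ cong (λ x → suc t₀ + (∑[ j < suc t₀ ] inside j + x)) (∑-rotate inside) ⟩
    suc t₀ + (∑[ j < suc t₀ ] inside j + ∑[ j < suc t₀ ] inside j)
                                                             ≡⟨ cong (λ x → suc t₀ + (x + x)) card≡∑inside ⟨
    suc t₀ + (card S + card S)                               ∎
    where open ≤-Reasoning

  ⌈r/2⌉*⌈t/2⌉≤∣S∣ : ⌈ r /2⌉ * ⌈ suc t₀ /2⌉ ≤ card S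
  ⌈r/2⌉*⌈t/2⌉≤∣S∣ = t*[q+q]≤t+[c+c]⇒q*⌈t/2⌉≤c {⌈ r /2⌉} {suc t₀} t*[⌈r/2⌉+⌈r/2⌉]≤t+[∣S∣+∣S∣]

corollary20 : (r t : ℕ) → 1 ≤ r → 3 ≤ t →
    (a b c : ℕ) → IsGammaO (K r) a → IsGammaO (C t) b →
    IsGammaO (K r □ C t) c → a * b ≤ c
corollary20 r (suc t₀) r≥1 (s≤s _) a b c γₒ[K]≡a γₒ[C]≡b ((S , S-alliance , ∣S∣≡c) , _) = begin
  a * b                  ≤⟨ *-mono-≤ (γₒ[K]≤⌈r/2⌉ r≥1 γₒ[K]≡a) (γₒ[C]≤⌈t/2⌉ γₒ[C]≡b) ⟩
  ⌈ r /2⌉ * ⌈ suc t₀ /2⌉ ≤⟨ ⌈r/2⌉*⌈t/2⌉≤∣S∣ {r} {t₀} S S-alliance ⟩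
  card S                 ≡⟨ ∣S∣≡c ⟩
  c                      ∎
  where open ≤-Reasoning
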